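{- Let $K\neq\emptyset$ and $(a_k)_{k\in K}$ a family in $\mathbf{V}$. Then $\bigwedge_{k\in K}\bigvee_{l\in K}(a_l\mathbin{\dot{ - }} a_k)=0$ iff for every $\epsilon\in\mathbf{V}^+$ there is $k\in K$ with $\bigvee_{l\in K}a_l\mathbin{\dot{ - }}\epsilon\le a_k$. Also, $\bigwedge_{k\in K}\bigvee_{l\in K}(a_k\mathbin{\dot{ - }} a_l)=0$ iff for every $\epsilon\in\mathbf{V}^+$ there is $k\in K$ with $a_k\mathbin{\dot{ - }}\epsilon\le\bigwedge_{l\in K}a_l$.
   Context: $\mathbf{V}$ is a value co-quantale: complete, completely distributive lattice with commutative monoid $(\mathbf{V},+,0)$, $0$ least and identity, $a+\bigwedge_ib_i=\bigwedge_i(a+b_i)$, $0\prec1$, and $\mathbf{V}^+=\{\epsilon:0\prec\epsilon\}$ closed under binary meets, where $\prec$ is the co-well-below relation. $a\mathbin{\dot{ - }} b:=\bigwedge\{r: r+b\ge a\}$. -}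

module Defs where

open import Data.Bool using (Bool; true; false; if_then_else_)
open import Data.Empty using (⊥; ⊥-elim)
open import Data.Product using (Σ; ∃; _×_; _,_; proj₁)
open import Relation.Binary.Structures using (IsPartialOrder)
open import Algebra.Structures using (IsCommutativeMonoid)

module _ {C : Set} (_≤_ : C → C → Set)
         (⋀ : {I : Set} → (I → C) → C) where

  CoWellBelow : C → C → Set₁
  CoWellBelow a b = ∀ {I : Set} (f : I → C) → ⋀ f ≤ a → ∃ λ i → f i ≤ b

  topOf : C
  topOf = ⋀ {⊥} ⊥-elim

  meetOf : C → C → C
  meetOf a b = ⋀ {Bool} (λ x → if x then a else b)

record ValueCoQuantale : Set₂ where
  infixl 6 _+_
  infix  4 _≈_ _≤_
  field
    Carrier : Set
    _≈_     : Carrier → Carrier → Set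
    _≤_     : Carrier → Carrier → Set
    isPartialOrder : IsPartialOrder _≈_ _≤_
    ⋀ : {I : Set} → (I → Carrier) → Carrier
    ⋀-lb  : ∀ {I : Set} (f : I → Carrier) (i : I) → ⋀ f ≤ f i
    ⋀-glb : ∀ {I : Set} (f : I → Carrier) (x : Carrier) → (∀ i → x ≤ f i) → x ≤ ⋀ f
    ⋁ : {I : Set} → (I → Carrier) → Carrier
    ⋁-ub  : ∀ {I : Set} (f : I → Carrier) (i : I) → f i ≤ ⋁ f
    ⋁-lub : ∀ {I : Set} (f : I → Carrier) (x : Carrier) → (∀ i → f i ≤ x) → ⋁ f ≤ x
    completelyDistributive :
      ∀ {I : Set} {J : I → Set} (f : (i : I) → J i → Carrier) →
      ⋀ (λ i → ⋁ (f i)) ≈ ⋁ {(i : I) → J i} (λ g → ⋀ (λ i → f i (g i)))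
    -- ... and its equivalent (Raney) formulation via the co-well-below relation
    -- a = ⋀ { b : a ≺ b }; stated as: every lower bound of { b : a ≺ b }
    -- is below a (the set {b : a ≺ b} lives in Set₁, so we cannot index ⋀
    -- by it; the reverse inequality a ≤ b for a ≺ b is automatic).
    coWellBelowApprox :
      ∀ (a x : Carrier) → (∀ (b : Carrier) → CoWellBelow _≤_ ⋀ a b → x ≤ b) → x ≤ a
    _+_ : Carrier → Carrier → Carrier
    0#  : Carrier
    +-isCommutativeMonoid : IsCommutativeMonoid _≈_ _+_ 0#
    0-least : ∀ (a : Carrier) → 0# ≤ a
    +-distrib-⋀ : ∀ (a : Carrier) {I : Set} (f : I → Carrier) →
                  a + ⋀ f ≈ ⋀ (λ i → a + f i)
    0≺⊤ : CoWellBelow _≤_ ⋀ 0# (topOf _≤_ ⋀)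
    V⁺-meet : ∀ (e d : Carrier) → CoWellBelow _≤_ ⋀ 0# e → CoWellBelow _≤_ ⋀ 0# d →
              CoWellBelow _≤_ ⋀ 0# (meetOf _≤_ ⋀ e d)

  _≺_ : Carrier → Carrier → Set₁
  _≺_ = CoWellBelow _≤_ ⋀

  Pos : Carrier → Set₁
  Pos ε = 0# ≺ ε

  infixl 6 _∸_
  _∸_ : Carrier → Carrier → Carrier
  a ∸ b = ⋀ {Σ Carrier (λ r → a ≤ r + b)} proj₁

{-# OPTIONS --safe #-}
module Submission where

-- Since 0 is the meet of the positive
-- elements (0 = ⋀ {ε : 0 ≺ ε}), a meet ⋀ₖ gₖ is 0 exactly when every positive ε
-- dominates some gₖ.  It then suffices to rewrite gₖ ≤ ε pointwise, using the
-- adjunction  a ∸ b ≤ r ⇔ a ≤ r + b  and the commutativity of +, which make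
-- a ∸ b ≤ ε and a ∸ ε ≤ b equivalent.

open import Defs
open import Data.Bool using (Bool; true; false; if_then_else_)
open import Data.Product using (Σ; _×_; _,_; proj₁)
open import Function.Bundles using (_⇔_; mk⇔; module Equivalence)
open import Relation.Binary.Structures using (IsPartialOrder; IsEquivalence)
open import Algebra.Structures using (IsCommutativeMonoid)

module Properties (V : ValueCoQuantale) where
  open ValueCoQuantale V
  open IsPartialOrder isPartialOrder using (reflexive; trans; antisym; isEquivalence)
    renaming (refl to ≤-refl)
  open IsEquivalence isEquivalence using () renaming (sym to ≈-sym; refl to ≈-refl)
  open IsCommutativeMonoid +-isCommutativeMonoid using (comm; ∙-cong)

  -- Monotonicity comes from distributivity over the meet of {x, y}, which is x.
  +-monoʳ-≤ : ∀ {x y} z → x ≤ y → z + x ≤ z + y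
  +-monoʳ-≤ {x} {y} z x≤y =
    trans (reflexive (∙-cong ≈-refl (≈-sym ⋀pair≈x)))
      (trans (reflexive (+-distrib-⋀ z pair)) (⋀-lb (λ b → z + pair b) false))
    where
      pair : Bool → Carrier
      pair b = if b then x else y
      x≤pair : ∀ b → x ≤ pair b
      x≤pair true  = ≤-refl
      x≤pair false = x≤y
      ⋀pair≈x : ⋀ pair ≈ x
      ⋀pair≈x = antisym (⋀-lb pair true) (⋀-glb pair x x≤pair)

  +-monoˡ-≤ : ∀ {x y} z → x ≤ y → x + z ≤ y + z
  +-monoˡ-≤ {x} {y} z x≤y =
    trans (reflexive (comm x z)) (trans (+-monoʳ-≤ z x≤y) (reflexive (comm z y)))

  ≤∸+ : ∀ a b → a ≤ a ∸ b + b
  ≤∸+ a b = trans (⋀-glb (λ s → b + proj₁ s) a (λ (r , a≤r+b) → trans a≤r+b (reflexive (comm r b))))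
              (trans (reflexive (≈-sym (+-distrib-⋀ b proj₁))) (reflexive (comm b (a ∸ b))))

  ≤+⇒∸≤ : ∀ {a b r} → a ≤ r + b → a ∸ b ≤ r
  ≤+⇒∸≤ {a} {b} {r} a≤r+b = ⋀-lb {Σ Carrier (λ r → a ≤ r + b)} proj₁ (r , a≤r+b)

  ∸≤⇒≤+ : ∀ {a b r} → a ∸ b ≤ r → a ≤ r + b
  ∸≤⇒≤+ {a} {b} a∸b≤r = trans (≤∸+ a b) (+-monoˡ-≤ b a∸b≤r)

  ∸-swap-≤ : ∀ {a b r} → a ∸ b ≤ r → a ∸ r ≤ b
  ∸-swap-≤ {b = b} {r = r} a∸b≤r = ≤+⇒∸≤ (trans (∸≤⇒≤+ a∸b≤r) (reflexive (comm r b)))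

  ⋁∸≤⇔⋁∸≤ : ∀ {L : Set} (f : L → Carrier) {b r} → ⋁ (λ l → f l ∸ b) ≤ r ⇔ ⋁ f ∸ r ≤ b
  ⋁∸≤⇔⋁∸≤ f {b} {r} = mk⇔
    (λ ⋁≤r → ≤+⇒∸≤ (⋁-lub f (b + r) λ l → ∸≤⇒≤+ (∸-swap-≤ (trans (⋁-ub (λ l → f l ∸ b) l) ⋁≤r))))
    (λ ⋁f∸r≤b → ⋁-lub (λ l → f l ∸ b) r λ l → ∸-swap-≤ (≤+⇒∸≤ (trans (⋁-ub f l) (∸≤⇒≤+ ⋁f∸r≤b))))

  ⋁∸≤⇔∸≤⋀ : ∀ {L : Set} (f : L → Carrier) {c r} → ⋁ (λ l → c ∸ f l) ≤ r ⇔ c ∸ r ≤ ⋀ f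
  ⋁∸≤⇔∸≤⋀ f {c} {r} = mk⇔
    (λ ⋁≤r → ⋀-glb f (c ∸ r) λ l → ∸-swap-≤ (trans (⋁-ub (λ l → c ∸ f l) l) ⋁≤r))
    (λ c∸r≤⋀f → ⋁-lub (λ l → c ∸ f l) r λ l → ∸-swap-≤ (trans c∸r≤⋀f (⋀-lb f l)))

  ⋀≈0#⇔Pos-attained : ∀ {K : Set} (g : K → Carrier) (P : Carrier → K → Set) →
                      (∀ {ε k} → g k ≤ ε ⇔ P ε k) →
                      ⋀ g ≈ 0# ⇔ (∀ ε → Pos ε → Σ K (P ε))
  ⋀≈0#⇔Pos-attained {K} g P g≤⇔P = mk⇔ attained ⋀≈0
    where
      attained : ⋀ g ≈ 0# → ∀ ε → Pos ε → Σ K (P ε)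
      attained ⋀g≈0 ε pos = let (k , gk≤ε) = pos g (reflexive ⋀g≈0) in k , Equivalence.to g≤⇔P gk≤ε
      ⋀≈0 : (∀ ε → Pos ε → Σ K (P ε)) → ⋀ g ≈ 0#
      ⋀≈0 att = antisym
        (coWellBelowApprox 0# (⋀ g) λ ε pos → let (k , Pεk) = att ε pos in
          trans (⋀-lb g k) (Equivalence.from g≤⇔P Pεk))
        (0-least (⋀ g))

mainTheorem13 : (V : ValueCoQuantale) → let open ValueCoQuantale V in
    {K : Set} → K → (a : K → Carrier) →
    ((⋀ (λ k → ⋁ (λ l → a l ∸ a k)) ≈ 0#)
    ⇔ (∀ (ε : Carrier) → Pos ε → Σ K (λ k → ⋁ a ∸ ε ≤ a k)))
    × ((⋀ (λ k → ⋁ (λ l → a k ∸ a l)) ≈ 0#)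
    ⇔ (∀ (ε : Carrier) → Pos ε → Σ K (λ k → a k ∸ ε ≤ ⋀ a)))
mainTheorem13 V _ a =
    ⋀≈0#⇔Pos-attained _ (λ ε k → ⋁ a ∸ ε ≤ a k) (⋁∸≤⇔⋁∸≤ a)
  , ⋀≈0#⇔Pos-attained _ (λ ε k → a k ∸ ε ≤ ⋀ a) (⋁∸≤⇔∸≤⋀ a)
  where open ValueCoQuantale V
        open Properties V
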